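{- Let $(Q,\rightarrow)$ be a finite transition system, $\mathscr{R}$ a preorder on $Q$ and $\mathscr{P}\subseteq\mathscr{R}$ an equivalence relation whose blocks have fixed representatives, such that there is neither a $(\mathscr{P},\mathscr{R})$-splitter transition of type 1 nor a $(\mathscr{P},\mathscr{R})$-splitter transition of type 2. Then $\mathscr{P}$ is $\mathscr{R}$-block-stable.
   Context: Composition: $\mathscr{S}\circ\mathscr{R}=\{(x,y)\mid\exists z,(x,z)\in\mathscr{R},(z,y)\in\mathscr{S}\}$; $\mathscr{R}(q)=\{q'\mid q\,\mathscr{R}\,q'\}$; $\rightarrow^{ -1}(B)=\{q\mid\exists b\in B,\ q\rightarrow b\}$. Blocks of a preorder $\mathscr{R}$: $[q]_{\mathscr{R}}=\{q'\mid q\,\mathscr{R}\,q'\wedge q'\,\mathscr{R}\,q\}$. Each block $E$ of $\mathscr{P}$ has a fixed representative $E.\mathit{rep}\in E$. $X\,\mathscr{R}\,Y$ means $(X\times Y)\cap\mathscr{R}\ne\emptyset$; $X\rightarrow Y$ means some $x\in X,y\in Y$ with $x\rightarrow y$. $\mathrm{RelCount}_{(\mathscr{P},\mathscr{R})}(E,B)=|\{E'\text{ block of }\mathscr{P}\mid E.\mathit{rep}\rightarrow E'\wedge B\,\mathscr{R}\,E'\}|$. A splitter transition of type 1 is a pair $(E,B)$, $E$ a block of $\mathscr{P}$, $B$ a block of $\mathscr{R}$, with $E\rightarrow B$ and $\mathrm{RelCount}_{(\mathscr{P},\mathscr{R})}(E,B)=0$. A splitter transition of type 2 is a pair $(E,B)$,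 $E$ a block of $\mathscr{P}$, $B$ a block of $\mathscr{R}$, with $E.\mathit{rep}\rightarrow B$, $\mathrm{RelCount}_{(\mathscr{P},\mathscr{R})}(E,B)=|\{[b]_{\mathscr{P}}\subseteq B\mid E.\mathit{rep}\rightarrow b\}|$, and $E\not\subseteq\rightarrow^{ -1}(B)$. An equivalence relation $\mathscr{P}\subseteq\mathscr{R}$ is $\mathscr{R}$-block-stable if for all $b,d,d'$, $d\,\mathscr{P}\,d'$ implies ($d\in(\rightarrow^{ -1}\circ\mathscr{R})(b)\iff d'\in(\rightarrow^{ -1}\circ\mathscr{R})(b)$). -}

module Defs where

open import Data.Nat using (ℕ; zero; suc; _+_)
open import Data.Bool using (Bool; true; false; if_then_else_; _∧_; not; T)
open import Data.Fin using (Fin; _≟_)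
open import Data.List using (List; allFin; map)
open import Data.Bool.ListAction using (any; all)
open import Data.Nat.ListAction using (sum)
open import Data.Product using (Σ; _×_; ∃; ∃-syntax)
open import Relation.Nullary.Decidable using (⌊_⌋)
open import Relation.Binary.PropositionalEquality using (_≡_)

-- Finite relations on Q = Fin n are given as Bool-valued (i.e. decidable) relations;
-- x ℛ y holds iff T (R x y).
Rel₂ : ℕ → Set
Rel₂ n = Fin n → Fin n → Bool

anyQ : ∀ {n} → (Fin n → Bool) → Bool
anyQ {n} f = any f (allFin n)

allQ : ∀ {n} → (Fin n → Bool) → Bool
allQ {n} f = all f (allFin n)

countQ : ∀ {n} → (Fin n → Bool) → ℕ
countQ {n} f = sum (map (λ x → if f x then 1 else 0) (allFin n))

IsPreorder : ∀ {n} → Rel₂ n → Set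
IsPreorder R = (∀ x → T (R x x)) × (∀ x y z → T (R x y) → T (R y z) → T (R x z))

IsEquivalence : ∀ {n} → Rel₂ n → Set
IsEquivalence P = (∀ x → T (P x x)) × (∀ x y → T (P x y) → T (P y x))
                × (∀ x y z → T (P x y) → T (P y z) → T (P x z))

_⊆ᵣ_ : ∀ {n} → Rel₂ n → Rel₂ n → Set
P ⊆ᵣ R = ∀ x y → T (P x y) → T (R x y)

IsRepresentative : ∀ {n} → Rel₂ n → (Fin n → Fin n) → Set
IsRepresentative P rep = (∀ q → T (P q (rep q))) × (∀ q q' → T (P q q') → rep q ≡ rep q')

module Sys {n : ℕ} (step R P : Rel₂ n) (rep : Fin n → Fin n) where

  inP : Fin n → Fin n → Bool
  inP e x = P e x

  inR : Fin n → Fin n → Bool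
  inR b x = R b x ∧ R x b

  -- c is the representative of its own ℘-block (so ℘-blocks ↔ such c)
  isRep : Fin n → Bool
  isRep c = ⌊ rep c ≟ c ⌋

  -- X ℛ Y for X = [b]_ℛ, Y = [c]_℘
  blockRel : Fin n → Fin n → Bool
  blockRel b c = anyQ (λ x → inR b x ∧ anyQ (λ y → inP c y ∧ R x y))

  repStep : Fin n → Fin n → Bool
  repStep e c = anyQ (λ y → inP c y ∧ step (rep e) y)

  -- RelCount(E, B) with E = [e]_℘, B = [b]_ℛ : number of ℘-blocks E' with E.rep → E' and B ℛ E'
  RelCount : Fin n → Fin n → ℕ
  RelCount e b = countQ (λ c → isRep c ∧ (repStep e c ∧ blockRel b c))

  -- |{[c]_℘ ⊆ B | E.rep → c}| (counting ℘-blocks, via representatives)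
  SuccBlocksIn : Fin n → Fin n → ℕ
  SuccBlocksIn e b =
    countQ (λ c → isRep c ∧ (allQ (λ x → not (inP c x) Data.Bool.∨ inR b x)
                            ∧ repStep e c))

  BlockStep : Fin n → Fin n → Set
  BlockStep e b = ∃[ x ] ∃[ y ] (T (inP e x) × T (inR b y) × T (step x y))

  RepStepB : Fin n → Fin n → Set
  RepStepB e b = ∃[ y ] (T (inR b y) × T (step (rep e) y))

  NotInPre : Fin n → Fin n → Set
  NotInPre e b = ∃[ x ] (T (inP e x) × (∀ y → T (inR b y) → T (step x y) → Data.Empty.⊥))
    where import Data.Empty

  -- splitter transitions, with E = [e]_℘ and B = [b]_ℛ
  Splitter1 : Fin n → Fin n → Set
  Splitter1 e b = BlockStep e b × RelCount e b ≡ 0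

  Splitter2 : Fin n → Fin n → Set
  Splitter2 e b = RepStepB e b × RelCount e b ≡ SuccBlocksIn e b × NotInPre e b

  InPreR : Fin n → Fin n → Set
  InPreR b d = ∃[ z ] (T (R b z) × T (step d z))

  BlockStable : Set
  BlockStable = ∀ b d d' → T (P d d') → (InPreR b d → InPreR b d') × (InPreR b d' → InPreR b d)

module Submission where

-- Let d ℘ d' and d → z with b ℛ z; we must find a successor of d' that lies
-- ℛ-above b (the converse direction is symmetric).
--   1. Since d → z, ([d]_℘, [z]_ℛ) is not a type-1 splitter, so RelCount is
--      positive: rep d steps into a ℘-block that [z]_ℛ is ℛ-related to, which
--      gives a successor y of rep d with z ℛ y.
--   2. Q is finite, so above y there is a successor w of rep d that is ℛ-maximal
--      among the successors of rep d.
--   3. For such a maximal w, a ℘-block reached from rep d is ℛ-related to [w]_ℛ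
--      iff it is contained in [w]_ℛ, so RelCount([d]_℘, [w]_ℛ) equals the number
--      of successor blocks inside [w]_ℛ.  Since ([d]_℘, [w]_ℛ) is not a type-2
--      splitter, every element of [d]_℘, in particular d', steps into [w]_ℛ.

open import Defs
open import Data.Nat using (ℕ; _≤_; _<_; z≤n; s≤s)
open import Data.Nat.Properties using (+-mono-≤; +-mono-<-≤; +-mono-≤-<)
open import Data.Nat.Induction using (<-wellFounded)
open import Data.Nat.ListAction using (sum)
open import Induction.WellFounded using (Acc; acc)
open import Data.Fin using (Fin)
open import Data.Fin.Properties using (any?)
open import Data.Bool using (Bool; true; false; _∧_; _∨_; not; T; if_then_else_)
open import Data.Bool.Properties using (T?; T-∧; T-≡)
open import Data.List using (List; []; _∷_; map; allFin)
open import Data.List.Properties using (map-cong)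
open import Data.List.Relation.Unary.Any as Any using (here; there; satisfied)
open import Data.List.Relation.Unary.Any.Properties using (any⁺; any⁻)
open import Data.List.Relation.Unary.All as All using ()
open import Data.List.Relation.Unary.All.Properties using (all⁺; all⁻)
open import Data.List.Membership.Propositional using (_∈_)
open import Data.List.Membership.Propositional.Properties using (∈-allFin)
open import Data.Product using (_×_; _,_; ∃-syntax; proj₁; proj₂)
open import Data.Empty using (⊥; ⊥-elim)
open import Function using (_∘_; Equivalence)
open import Relation.Nullary using (¬_; yes; no)
open import Relation.Nullary.Decidable using (_×-dec_; ¬?; decidable-stable)
open import Relation.Binary.PropositionalEquality using (_≡_; refl; cong)

∧⁺ : ∀ {a b} → T a → T b → T (a ∧ b)
∧⁺ p q = Equivalence.from T-∧ (p , q)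

∧⁻ : ∀ {a b} → T (a ∧ b) → T a × T b
∧⁻ {a} = Equivalence.to (T-∧ {a})

⇒⁺ : ∀ {a b} → (T a → T b) → T (not a ∨ b)
⇒⁺ {false} _ = _
⇒⁺ {true}  h = h _

⇒⁻ : ∀ {a b} → T (not a ∨ b) → T a → T b
⇒⁻ {true} p _ = p

T-injective : ∀ {a b} → (T a → T b) → (T b → T a) → a ≡ b
T-injective {false} {false} _  _    = refl
T-injective {true}  {true}  _  _    = refl
T-injective {false} {true}  _  from = ⊥-elim (from _)
T-injective {true}  {false} to _    = ⊥-elim (to _)

anyQ⁺ : ∀ {n} (f : Fin n → Bool) x → T (f x) → T (anyQ f)
anyQ⁺ {n} f x fx = any⁺ {xs = allFin n} f (Any.map (λ { refl → fx }) (∈-allFin x))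

anyQ⁻ : ∀ {n} (f : Fin n → Bool) → T (anyQ f) → ∃[ x ] T (f x)
anyQ⁻ {n} f = satisfied ∘ any⁻ f (allFin n)

allQ⁺ : ∀ {n} (f : Fin n → Bool) → (∀ x → T (f x)) → T (allQ f)
allQ⁺ {n} f h = all⁻ f {xs = allFin n} (All.tabulate (λ {x} _ → h x))

allQ⁻ : ∀ {n} (f : Fin n → Bool) → T (allQ f) → ∀ x → T (f x)
allQ⁻ f p x = All.lookup (all⁺ f _ p) (∈-allFin x)

-- Counting the elements of a list satisfying a Boolean predicate;
-- countQ f is definitionally count f (allFin n).

module Counting {A : Set} where

  indicator : Bool → ℕ
  indicator b = if b then 1 else 0

  count : (A → Bool) → List A → ℕ
  count f xs = sum (map (indicator ∘ f) xs)

  count-nonzero : ∀ (f : A → Bool) xs → ¬ count f xs ≡ 0 → ∃[ x ] T (f x)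
  count-nonzero f []       ≢0 = ⊥-elim (≢0 refl)
  count-nonzero f (x ∷ xs) ≢0 with f x in fx
  ... | true  = x , Equivalence.from T-≡ fx
  ... | false = count-nonzero f xs ≢0

  count-cong : ∀ (f g : A → Bool) xs → (∀ x → f x ≡ g x) → count f xs ≡ count g xs
  count-cong f g xs f≗g = cong sum (map-cong (cong indicator ∘ f≗g) xs)

  sum-map-mono : ∀ {φ ψ : A → ℕ} → (∀ x → φ x ≤ ψ x) →
                 ∀ xs → sum (map φ xs) ≤ sum (map ψ xs)
  sum-map-mono φ≤ψ []       = z≤n
  sum-map-mono φ≤ψ (x ∷ xs) = +-mono-≤ (φ≤ψ x) (sum-map-mono φ≤ψ xs)

  sum-map-strict : ∀ {φ ψ : A → ℕ} {a xs} → (∀ x → φ x ≤ ψ x) → a ∈ xs → φ a < ψ a →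
                   sum (map φ xs) < sum (map ψ xs)
  sum-map-strict {xs = _ ∷ xs} φ≤ψ (here refl) φa<ψa = +-mono-<-≤ φa<ψa (sum-map-mono φ≤ψ xs)
  sum-map-strict {xs = x ∷ _}  φ≤ψ (there a∈)  φa<ψa = +-mono-≤-< (φ≤ψ x) (sum-map-strict φ≤ψ a∈ φa<ψa)

  indicator-mono : ∀ {a b} → (T a → T b) → indicator a ≤ indicator b
  indicator-mono {false} {_}     _ = z≤n
  indicator-mono {true}  {true}  _ = s≤s z≤n
  indicator-mono {true}  {false} h = ⊥-elim (h _)

  indicator-strict : ∀ {a b} → ¬ T a → T b → indicator a < indicator b
  indicator-strict {false} {true} _ _ = s≤s z≤n
  indicator-strict {true}         ¬a _ = ⊥-elim (¬a _)

  count-strict : ∀ (f g : A → Bool) xs → (∀ x → T (f x) → T (g x)) →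
                 ∀ {a} → a ∈ xs → ¬ T (f a) → T (g a) → count f xs < count g xs
  count-strict f g xs f⇒g a∈ ¬fa ga =
    sum-map-strict (λ x → indicator-mono (f⇒g x)) a∈ (indicator-strict ¬fa ga)

open Counting using (count-nonzero; count-cong; count-strict)

module MaximalElements {n : ℕ} (R : Rel₂ n) (S : Fin n → Bool) where

  Maximal : Fin n → Set
  Maximal w = ∀ v → T (S v) → T (R w v) → T (R v w)

  -- The number of elements of S lying ℛ-above w; it decreases along strict ℛ-steps.
  above : Fin n → ℕ
  above w = countQ (λ v → S v ∧ R w v)

  module _ (preR : IsPreorder R) where

    private
      R-trans : ∀ {x y z} → T (R x y) → T (R y z) → T (R x z)
      R-trans = proj₂ preR _ _ _

    fewer-above : ∀ {y v} → T (S y) → T (R y v) → ¬ T (R v y) → above v < above y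
    fewer-above {y} sy yv ¬vy =
      count-strict _ _ (allFin n)
        (λ x svx → let sx , vx = ∧⁻ svx in ∧⁺ sx (R-trans yv vx))
        (∈-allFin y) (¬vy ∘ proj₂ ∘ ∧⁻) (∧⁺ sy (proj₁ preR y))

    maximal-above : ∀ y → T (S y) → ∃[ w ] (T (S w) × T (R y w) × Maximal w)
    maximal-above y sy = climb y sy (<-wellFounded (above y))
      where
      climb : ∀ y → T (S y) → Acc _<_ (above y) → ∃[ w ] (T (S w) × T (R y w) × Maximal w)
      climb y sy (acc rec)
        with any? (λ v → T? (S v) ×-dec T? (R y v) ×-dec ¬? (T? (R v y)))
      ... | yes (v , sv , yv , ¬vy) =
        let w , sw , vw , maxw = climb v sv (rec (fewer-above sy yv ¬vy))
        in w , sw , R-trans yv vw , maxw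
      ... | no nothing-strictly-above =
        y , sy , proj₁ preR y ,
        λ v sv yv → decidable-stable (T? (R v y)) (λ ¬vy → nothing-strictly-above (v , sv , yv , ¬vy))

open MaximalElements using (Maximal; maximal-above)

module BlockStability {n : ℕ} (step R P : Rel₂ n) (rep : Fin n → Fin n)
  (preR : IsPreorder R) (eqP : IsEquivalence P) (P⊆R : P ⊆ᵣ R) where

  open Sys step R P rep

  R-refl : ∀ x → T (R x x)
  R-refl = proj₁ preR

  R-trans : ∀ {x y z} → T (R x y) → T (R y z) → T (R x z)
  R-trans = proj₂ preR _ _ _

  P-sym : ∀ {x y} → T (P x y) → T (P y x)
  P-sym = proj₁ (proj₂ eqP) _ _

  same-block⇒R : ∀ {c x y} → T (P c x) → T (P c y) → T (R x y)
  same-block⇒R cx cy = P⊆R _ _ (proj₂ (proj₂ eqP) _ _ _ (P-sym cx) cy)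

  inR-refl : ∀ w → T (inR w w)
  inR-refl w = ∧⁺ (R-refl w) (R-refl w)

  repStep⁻ : ∀ {e c} → T (repStep e c) → ∃[ y ] (T (P c y) × T (step (rep e) y))
  repStep⁻ {e} {c} p =
    let y , cy∧ey = anyQ⁻ (λ y → inP c y ∧ step (rep e) y) p in y , ∧⁻ {P c y} cy∧ey

  blockRel⁺ : ∀ {b c y} → T (inR b y) → T (P c y) → T (blockRel b c)
  blockRel⁺ {b} {c} {y} by cy =
    anyQ⁺ (λ x → inR b x ∧ anyQ (λ y → inP c y ∧ R x y)) y
          (∧⁺ by (anyQ⁺ (λ y' → inP c y' ∧ R y y') y (∧⁺ cy (R-refl y))))

  blockRel⁻ : ∀ {b c} → T (blockRel b c) → ∃[ y ] (T (P c y) × T (R b y))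
  blockRel⁻ {b} {c} p =
    let x , bx∧rest = anyQ⁻ (λ x → inR b x ∧ anyQ (λ y → inP c y ∧ R x y)) p
        bx , rest   = ∧⁻ {inR b x} bx∧rest
        y , cy∧xy   = anyQ⁻ (λ y → inP c y ∧ R x y) rest
        cy , xy     = ∧⁻ {P c y} cy∧xy
    in y , cy , R-trans (proj₁ (∧⁻ {R b x} bx)) xy

  successor-above : (∀ e b → ¬ Splitter1 e b) →
                    ∀ {d z} → T (step d z) → ∃[ y ] (T (step (rep d) y) × T (R z y))
  successor-above no1 {d} {z} dz =
    let c , hc      = count-nonzero (λ c → isRep c ∧ (repStep d c ∧ blockRel z c)) (allFin n)
                                    (λ count≡0 → no1 d z (d→z , count≡0))
        reach , rel = ∧⁻ {repStep d c} (proj₂ (∧⁻ {isRep c} hc))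
        y , cy , dy = repStep⁻ reach
        x , cx , zx = blockRel⁻ rel
    in y , dy , R-trans zx (same-block⇒R cx cy)
    where
    d→z : BlockStep d z
    d→z = d , z , proj₁ eqP d , inR-refl z , dz

  -- [c]_℘ ⊆ [w]_ℛ, the membership test in SuccBlocksIn.
  Inside : Fin n → Fin n → Bool
  Inside w c = allQ (λ x → not (inP c x) ∨ inR w x)

  inside⇒related : ∀ {e w c} → T (repStep e c) → T (Inside w c) → T (blockRel w c)
  inside⇒related {w = w} {c} reach inside =
    let u , cu , _ = repStep⁻ reach
    in blockRel⁺ (⇒⁻ {P c u} (allQ⁻ (λ x → not (inP c x) ∨ inR w x) inside u) cu) cu

  related⇒inside : ∀ {e w c} → Maximal R (step (rep e)) w →
                   T (repStep e c) → T (blockRel w c) → T (Inside w c)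
  related⇒inside {w = w} {c} maxw reach rel =
    let u , cu , eu = repStep⁻ reach
        y , cy , wy = blockRel⁻ rel
        wu          = R-trans wy (same-block⇒R cy cu)
        uw          = maxw u eu wu
    in allQ⁺ (λ x → not (inP c x) ∨ inR w x) λ v → ⇒⁺ {P c v} λ cv →
         ∧⁺ (R-trans wu (same-block⇒R cu cv)) (R-trans (same-block⇒R cv cu) uw)

  balanced-at-maximal : ∀ {e w} → Maximal R (step (rep e)) w → RelCount e w ≡ SuccBlocksIn e w
  balanced-at-maximal maxw = count-cong _ _ (allFin n) λ c →
    cong (isRep c ∧_) (T-injective
      (λ h → let reach , rel = ∧⁻ h in ∧⁺ (related⇒inside maxw reach rel) reach)
      (λ h → let inside , reach = ∧⁻ h in ∧⁺ reach (inside⇒related reach inside)))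

  steps-into-maximal : (∀ e b → ¬ Splitter2 e b) →
                       ∀ {e w d'} → T (step (rep e) w) → Maximal R (step (rep e)) w →
                       T (P e d') → ∃[ u ] (T (inR w u) × T (step d' u))
  steps-into-maximal no2 {e} {w} {d'} ew maxw ed' =
    decidable-stable (any? λ u → T? (inR w u) ×-dec T? (step d' u)) λ no-step →
      no2 e w ((w , inR-refl w , ew) , balanced-at-maximal maxw ,
               d' , ed' , λ u wu d'u → no-step (u , wu , d'u))

  transfer : (∀ e b → ¬ Splitter1 e b) → (∀ e b → ¬ Splitter2 e b) →
             ∀ b d d' → T (P d d') → InPreR b d → InPreR b d'
  transfer no1 no2 b d d' dd' (z , bz , dz) =
    let y , dy , zy         = successor-above no1 dz
        w , dw , yw , maxw  = maximal-above R (step (rep d)) preR y dy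
        u , wu , d'u        = steps-into-maximal no2 dw maxw dd'
    in u , R-trans bz (R-trans zy (R-trans yw (proj₁ (∧⁻ {R w u} wu)))) , d'u

theorem2 : (n : ℕ) (step R P : Rel₂ n) (rep : Fin n → Fin n) →
    IsPreorder R → IsEquivalence P → P ⊆ᵣ R → IsRepresentative P rep →
    (∀ e b → Sys.Splitter1 step R P rep e b → ⊥) →
    (∀ e b → Sys.Splitter2 step R P rep e b → ⊥) →
    Sys.BlockStable step R P rep
theorem2 n step R P rep preR eqP P⊆R _ no1 no2 b d d' dd' =
  transfer no1 no2 b d d' dd' , transfer no1 no2 b d' d (P-sym dd')
  where open BlockStability step R P rep preR eqP P⊆R
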